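{- Let $k=3$. If $G$ is a triangle-free graph of order $n$ with $e_\phi(G)=ex_\phi(n,K_3)$, then $G\in\mathcal{G}_n^*$, where $\mathcal{G}_n^*$ is the set of complete bipartite graphs $K_{x,n-x}$ for which $x(n-x)$ is closest to $(n^2-3n+4)/4$.
   Context: All graphs are finite, simple and undirected. For a positive integer $k$ and a graph $G$ with degree sequence $d_1,\ldots,d_n$, define $e_\phi(G)=\sum_{i=1}^n\binom{d_i}{k}$. $ex_\phi(n,K_3)$ denotes the maximum of $e_\phi(G)$ over all triangle-free graphs $G$ on $n$ vertices. Throughout, $k\leq n/2$ is assumed. -}

module Defs where

open import Data.Bool using (Bool; true; false; if_then_else_)
open import Data.Nat using (ℕ; _+_; _*_; _≤_)
open import Data.Nat.Combinatorics using (_C_)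
open import Data.Fin using (Fin)
open import Data.List using (List; map; allFin)
open import Data.Nat.ListAction using (sum)
open import Data.Integer as ℤ using (ℤ; +_; ∣_∣)
open import Data.Product using (Σ; _×_; ∃-syntax)
open import Relation.Binary.PropositionalEquality using (_≡_; _≢_)
open import Relation.Nullary using (¬_)

record Graph (n : ℕ) : Set where
  field
    adj   : Fin n → Fin n → Bool
    sym   : ∀ i j → adj i j ≡ adj j i
    irrefl : ∀ i → adj i i ≡ false
open Graph public

count : {n : ℕ} → (Fin n → Bool) → ℕ
count {n} p = sum (map (λ j → if p j then 1 else 0) (allFin n))

degree : {n : ℕ} → Graph n → Fin n → ℕ
degree G i = count (adj G i)

eφ : {n : ℕ} → ℕ → Graph n → ℕ
eφ {n} k G = sum (map (λ i → degree G i C k) (allFin n))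

TriangleFree : {n : ℕ} → Graph n → Set
TriangleFree G = ∀ i j l → adj G i j ≡ true → adj G j l ≡ true → adj G l i ≡ false

IsExtremal : {n : ℕ} → ℕ → Graph n → Set
IsExtremal {n} k G = TriangleFree G × (∀ (H : Graph n) → TriangleFree H → eφ k H ≤ eφ k G)

_xor_ : Bool → Bool → Bool
true  xor b = if b then false else true
false xor b = b

-- G is (isomorphic to) K_{x, n-x}: there is a bipartition with x vertices on the
-- 'true' side such that two vertices are adjacent iff they are on different sides.
IsCompleteBipartite : {n : ℕ} → Graph n → ℕ → Set
IsCompleteBipartite G x =
  ∃[ side ] (count side ≡ x × (∀ i j → adj G i j ≡ (side i xor side j)))

-- distance, scaled by 4, between x(n-x) and (n² - 3n + 4)/4:  |4x(n-x) - (n²-3n+4)|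
dist : ℕ → ℕ → ℕ
dist n x = ∣ (+ 4) ℤ.* (+ x) ℤ.* ((+ n) ℤ.- (+ x)) ℤ.- ((+ (n * n) ℤ.+ + 4) ℤ.- (+ (3 * n))) ∣

Closest : ℕ → ℕ → Set
Closest n x = x ≤ n × (∀ y → y ≤ n → dist n x ≤ dist n y)

InGstar : {n : ℕ} → Graph n → Set
InGstar {n} G = ∃[ x ] (Closest n x × IsCompleteBipartite G x)

module Submission where

-- Let G be extremal, v a vertex of maximum degree Δ, N its neighbourhood and
-- m = n - Δ.  Triangle-freeness puts the neighbourhood of every u ∈ N outside N,
-- so deg u ≤ m, while every other vertex has degree ≤ Δ; hence
-- e_φ(G) ≤ Δ·C(m,3) + m·C(Δ,3) = e_φ(K_{Δ,m}).  Since K_{Δ,m} is itself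
-- triangle-free, extremality forces equality, and then every single degree bound
-- is attained.  Comparing with the star K_{1,n-1} gives Δ ≥ 3, where C(·,3) is
-- strictly increasing, so the degrees themselves are determined; a short
-- counting argument then shows that G is exactly the complete bipartite graph
-- with sides N and its complement.  Finally the polynomial identity
-- 48·e_φ(K_{a,n-a}) + (4a(n-a) - (n²-3n+4))² = (n²-3n+4)² turns "Δ maximises
-- e_φ(K_{a,n-a})" into "Δ(n-Δ) is closest to (n²-3n+4)/4".

open import Defs hiding (sym)

module BipartiteArithmetic where

  open import Data.Nat as ℕ using (ℕ; zero; suc; _≤_)
  import Data.Nat.Properties as ℕP
  open import Data.Nat.Combinatorics using (_C_; nCk+nC[k+1]≡[n+1]C[k+1]; nC1≡n)
  open import Data.Integer using (ℤ; +_; -[1+_]; ∣_∣; _+_; _*_; _-_)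
  open import Data.Integer.Properties using (pos-+; pos-*; +◃n≡+n; +-injective)
  open import Data.Integer.Tactic.RingSolver using (solve-∀)
  open import Data.Product using (_,_)
  open import Relation.Binary.PropositionalEquality
  open import Relation.Nullary using (yes; no)
  open import Data.Empty using (⊥-elim)

  -- e_φ(K_{a,b}) for parameter k: a vertices of degree b and b vertices of degree a.
  eφK : ℕ → ℕ → ℕ → ℕ
  eφK k a b = (b C k) ℕ.* a ℕ.+ (a C k) ℕ.* b

  C2-poly : ∀ a → + ((a C 2) ℕ.* 2) ≡ + a * (+ a - + 1)
  C2-poly zero = refl
  C2-poly (suc a) = begin
      + ((suc a C 2) ℕ.* 2)
        ≡⟨ cong (λ t → + (t ℕ.* 2)) (sym (nCk+nC[k+1]≡[n+1]C[k+1] a 1)) ⟩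
      + (((a C 1) ℕ.+ (a C 2)) ℕ.* 2)
        ≡⟨ cong (λ t → + ((t ℕ.+ (a C 2)) ℕ.* 2)) (nC1≡n a) ⟩
      + ((a ℕ.+ (a C 2)) ℕ.* 2)
        ≡⟨ cong +_ (ℕP.*-distribʳ-+ 2 a (a C 2)) ⟩
      + (a ℕ.* 2 ℕ.+ (a C 2) ℕ.* 2)
        ≡⟨ pos-+ (a ℕ.* 2) _ ⟩
      + (a ℕ.* 2) + + ((a C 2) ℕ.* 2)
        ≡⟨ cong₂ _+_ (pos-* a 2) (C2-poly a) ⟩
      + a * + 2 + + a * (+ a - + 1)
        ≡⟨ step (+ a) ⟩
      (+ 1 + + a) * ((+ 1 + + a) - + 1)
        ≡⟨ cong (λ t → t * (t - + 1)) (sym (pos-+ 1 a)) ⟩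
      + suc a * (+ suc a - + 1) ∎
    where
    open ≡-Reasoning
    step : ∀ x → x * + 2 + x * (x - + 1) ≡ (+ 1 + x) * ((+ 1 + x) - + 1)
    step = solve-∀

  C3-poly : ∀ a → + ((a C 3) ℕ.* 6) ≡ + a * (+ a - + 1) * (+ a - + 2)
  C3-poly zero = refl
  C3-poly (suc a) = begin
      + ((suc a C 3) ℕ.* 6)
        ≡⟨ cong (λ t → + (t ℕ.* 6)) (sym (nCk+nC[k+1]≡[n+1]C[k+1] a 2)) ⟩
      + (((a C 2) ℕ.+ (a C 3)) ℕ.* 6)
        ≡⟨ cong +_ (ℕP.*-distribʳ-+ 6 (a C 2) (a C 3)) ⟩
      + ((a C 2) ℕ.* 6 ℕ.+ (a C 3) ℕ.* 6)
        ≡⟨ pos-+ ((a C 2) ℕ.* 6) _ ⟩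
      + ((a C 2) ℕ.* 6) + + ((a C 3) ℕ.* 6)
        ≡⟨ cong (_+ + ((a C 3) ℕ.* 6)) (cong +_ (sym (ℕP.*-assoc (a C 2) 2 3))) ⟩
      + (((a C 2) ℕ.* 2) ℕ.* 3) + + ((a C 3) ℕ.* 6)
        ≡⟨ cong₂ _+_ (trans (pos-* ((a C 2) ℕ.* 2) 3) (cong (_* + 3) (C2-poly a))) (C3-poly a) ⟩
      + a * (+ a - + 1) * + 3 + + a * (+ a - + 1) * (+ a - + 2)
        ≡⟨ step (+ a) ⟩
      (+ 1 + + a) * ((+ 1 + + a) - + 1) * ((+ 1 + + a) - + 2)
        ≡⟨ cong (λ t → t * (t - + 1) * (t - + 2)) (sym (pos-+ 1 a)) ⟩
      + suc a * (+ suc a - + 1) * (+ suc a - + 2) ∎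
    where
    open ≡-Reasoning
    step : ∀ x → x * (x - + 1) * + 3 + x * (x - + 1) * (x - + 2)
               ≡ (+ 1 + x) * ((+ 1 + x) - + 1) * ((+ 1 + x) - + 2)
    step = solve-∀

  K : ℕ → ℤ
  K n = (+ (n ℕ.* n) + + 4) - + (3 ℕ.* n)

  D : ℕ → ℕ → ℤ
  D n x = (+ 4) * (+ x) * ((+ n) - (+ x)) - K n

  identity-poly : ∀ A B →
    + 8 * (B * (B - + 1) * (B - + 2) * A + A * (A - + 1) * (A - + 2) * B)
     + ((+ 4) * A * ((A + B) - A) - (((A + B) * (A + B) + + 4) - + 3 * (A + B)))
     * ((+ 4) * A * ((A + B) - A) - (((A + B) * (A + B) + + 4) - + 3 * (A + B)))
     ≡ (((A + B) * (A + B) + + 4) - + 3 * (A + B)) * (((A + B) * (A + B) + + 4) - + 3 * (A + B))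
  identity-poly = solve-∀

  K-cast : ∀ a b → K (a ℕ.+ b) ≡ ((+ a + + b) * (+ a + + b) + + 4) - + 3 * (+ a + + b)
  K-cast a b = cong₂ (λ s t → (s + + 4) - t)
    (trans (pos-* (a ℕ.+ b) (a ℕ.+ b)) (cong₂ _*_ (pos-+ a b) (pos-+ a b)))
    (trans (pos-* 3 (a ℕ.+ b)) (cong (+ 3 *_) (pos-+ a b)))

  eφK-cast : ∀ a b → + (48 ℕ.* eφK 3 a b)
    ≡ + 8 * (+ b * (+ b - + 1) * (+ b - + 2) * + a + + a * (+ a - + 1) * (+ a - + 2) * + b)
  eφK-cast a b = begin
      + (48 ℕ.* eφK 3 a b)
        ≡⟨ cong +_ (regroup a b (b C 3) (a C 3)) ⟩
      + (8 ℕ.* (((b C 3) ℕ.* 6) ℕ.* a ℕ.+ ((a C 3) ℕ.* 6) ℕ.* b))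
        ≡⟨ pos-* 8 (((b C 3) ℕ.* 6) ℕ.* a ℕ.+ ((a C 3) ℕ.* 6) ℕ.* b) ⟩
      + 8 * + (((b C 3) ℕ.* 6) ℕ.* a ℕ.+ ((a C 3) ℕ.* 6) ℕ.* b)
        ≡⟨ cong (+ 8 *_) (pos-+ (((b C 3) ℕ.* 6) ℕ.* a) _) ⟩
      + 8 * (+ (((b C 3) ℕ.* 6) ℕ.* a) + + (((a C 3) ℕ.* 6) ℕ.* b))
        ≡⟨ cong₂ (λ s t → + 8 * (s + t))
             (trans (pos-* ((b C 3) ℕ.* 6) a) (cong (_* + a) (C3-poly b)))
             (trans (pos-* ((a C 3) ℕ.* 6) b) (cong (_* + b) (C3-poly a))) ⟩
      + 8 * (+ b * (+ b - + 1) * (+ b - + 2) * + a + + a * (+ a - + 1) * (+ a - + 2) * + b) ∎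
    where
    open ≡-Reasoning
    regroup : ∀ a b c3 d3 → 48 ℕ.* (c3 ℕ.* a ℕ.+ d3 ℕ.* b)
                          ≡ 8 ℕ.* ((c3 ℕ.* 6) ℕ.* a ℕ.+ (d3 ℕ.* 6) ℕ.* b)
    regroup = NatSolver.solve-∀
      where import Data.Nat.Tactic.RingSolver as NatSolver

  square-abs : ∀ i → + (∣ i ∣ ℕ.* ∣ i ∣) ≡ i * i
  square-abs (+ n) = sym (+◃n≡+n (n ℕ.* n))
  square-abs -[1+ n ] = refl

  key-identity : ∀ n a b → a ℕ.+ b ≡ n →
    + (48 ℕ.* eφK 3 a b ℕ.+ dist n a ℕ.* dist n a) ≡ K n * K n
  key-identity n a b refl = begin
      + (48 ℕ.* eφK 3 a b ℕ.+ dist n a ℕ.* dist n a)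
        ≡⟨ pos-+ (48 ℕ.* eφK 3 a b) _ ⟩
      + (48 ℕ.* eφK 3 a b) + + (dist n a ℕ.* dist n a)
        ≡⟨ cong₂ _+_ (eφK-cast a b) (square-abs (D n a)) ⟩
      P + D n a * D n a
        ≡⟨ cong (λ t → P + t * t) D-cast ⟩
      P + Dp * Dp
        ≡⟨ identity-poly A B ⟩
      Kp * Kp
        ≡⟨ cong (λ t → t * t) (sym (K-cast a b)) ⟩
      K n * K n ∎
    where
    open ≡-Reasoning
    A B Kp Dp P : ℤ
    A = + a
    B = + b
    Kp = ((A + B) * (A + B) + + 4) - + 3 * (A + B)
    Dp = (+ 4) * A * ((A + B) - A) - Kp
    P = + 8 * (B * (B - + 1) * (B - + 2) * A + A * (A - + 1) * (A - + 2) * B)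
    D-cast : D n a ≡ Dp
    D-cast = cong₂ (λ s t → (+ 4) * A * (s - A) - t) (pos-+ a b) (K-cast a b)

  squares-reflect-≤ : ∀ x y → x ℕ.* x ≤ y ℕ.* y → x ≤ y
  squares-reflect-≤ x y x²≤y² with x ℕ.≤? y
  ... | yes x≤y = x≤y
  ... | no x≰y = ⊥-elim (ℕP.<⇒≱ (ℕP.*-mono-< y<x y<x) x²≤y²)
    where y<x = ℕP.≰⇒> x≰y

  closest : ∀ n x b → x ℕ.+ b ≡ n →
    (∀ y c → y ℕ.+ c ≡ n → eφK 3 y c ≤ eφK 3 x b) → Closest n x
  closest n x b x+b≡n maximal = x≤n , λ y y≤n → squares-reflect-≤ _ _ (dist²≤ y y≤n)
    where
    x≤n : x ≤ n
    x≤n = subst (x ≤_) x+b≡n (ℕP.m≤m+n x b)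
    dist²≤ : ∀ y → y ≤ n → dist n x ℕ.* dist n x ≤ dist n y ℕ.* dist n y
    dist²≤ y y≤n = ℕP.+-cancelˡ-≤ (48 ℕ.* eφK 3 y c) _ _ (begin
        48 ℕ.* eφK 3 y c ℕ.+ dist n x ℕ.* dist n x
          ≤⟨ ℕP.+-monoˡ-≤ _ (ℕP.*-monoʳ-≤ 48 (maximal y c y+c≡n)) ⟩
        48 ℕ.* eφK 3 x b ℕ.+ dist n x ℕ.* dist n x
          ≡⟨ +-injective (trans (key-identity n x b x+b≡n) (sym (key-identity n y c y+c≡n))) ⟩
        48 ℕ.* eφK 3 y c ℕ.+ dist n y ℕ.* dist n y ∎)
      where
      open ℕP.≤-Reasoning
      c = n ℕ.∸ y
      y+c≡n : y ℕ.+ c ≡ n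
      y+c≡n = ℕP.m+[n∸m]≡n y≤n

open BipartiteArithmetic using (eφK; closest)

open import Data.Bool using (Bool; true; false; if_then_else_; not; _∧_)
open import Data.Bool.Properties using (if-float; ∧-zeroʳ; ∧-identityʳ)
open import Data.Nat
open import Data.Nat.Properties
open import Data.Nat.Combinatorics using (_C_; nCk+nC[k+1]≡[n+1]C[k+1]; k>n⇒nCk≡0)
open import Data.Fin using (Fin; zero; suc) renaming (_≟_ to _≟ᶠ_)
open import Data.List using (map; allFin; tabulate)
open import Data.List.Properties using (map-tabulate)
open import Data.Nat.ListAction using (sum)
open import Data.Product using (Σ; _,_; proj₁; proj₂)
open import Data.Sum using (inj₁; inj₂)
open import Data.Empty using (⊥; ⊥-elim)
open import Function using (_∘_; id)
open import Relation.Nullary using (yes; no)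
open import Relation.Nullary.Decidable using (⌊_⌋)
open import Relation.Binary.PropositionalEquality

-- Sums over Fin n, defined by recursion so that induction on n is available.
sumFin : ∀ {n} → (Fin n → ℕ) → ℕ
sumFin {zero} f = 0
sumFin {suc n} f = f zero + sumFin (f ∘ suc)

sum-allFin : ∀ {n} (f : Fin n → ℕ) → sum (map f (allFin n)) ≡ sumFin f
sum-allFin {n} f = trans (cong sum (map-tabulate id f)) (sum-tabulate f)
  where
  sum-tabulate : ∀ {n} (f : Fin n → ℕ) → sum (tabulate f) ≡ sumFin f
  sum-tabulate {zero} f = refl
  sum-tabulate {suc n} f = cong (f zero +_) (sum-tabulate (f ∘ suc))

sumFin-cong : ∀ {n} {f g : Fin n → ℕ} → (∀ i → f i ≡ g i) → sumFin f ≡ sumFin g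
sumFin-cong {zero} f≡g = refl
sumFin-cong {suc n} f≡g = cong₂ _+_ (f≡g zero) (sumFin-cong (f≡g ∘ suc))

sumFin-mono : ∀ {n} {f g : Fin n → ℕ} → (∀ i → f i ≤ g i) → sumFin f ≤ sumFin g
sumFin-mono {zero} f≤g = z≤n
sumFin-mono {suc n} f≤g = +-mono-≤ (f≤g zero) (sumFin-mono (f≤g ∘ suc))

sumFin-mono-< : ∀ {n} {f g : Fin n → ℕ} → (∀ i → f i ≤ g i) →
  (a : Fin n) → f a < g a → sumFin f < sumFin g
sumFin-mono-< {suc n} f≤g zero lt = +-mono-<-≤ lt (sumFin-mono (f≤g ∘ suc))
sumFin-mono-< {suc n} f≤g (suc a) lt = +-mono-≤-< (f≤g zero) (sumFin-mono-< (f≤g ∘ suc) a lt)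

sumFin-tight : ∀ {n} {f g : Fin n → ℕ} → (∀ i → f i ≤ g i) → sumFin f ≡ sumFin g →
  ∀ i → f i ≡ g i
sumFin-tight f≤g sums≡ i with m≤n⇒m<n∨m≡n (f≤g i)
... | inj₂ fi≡gi = fi≡gi
... | inj₁ fi<gi = ⊥-elim (<⇒≢ (sumFin-mono-< f≤g i fi<gi) sums≡)

sumFin-const : ∀ n c → sumFin {n} (λ _ → c) ≡ n * c
sumFin-const zero c = refl
sumFin-const (suc n) c = cong (c +_) (sumFin-const n c)

ind : Bool → ℕ
ind b = if b then 1 else 0

cnt : ∀ {n} → (Fin n → Bool) → ℕ
cnt p = sumFin (ind ∘ p)

count≡cnt : ∀ {n} (p : Fin n → Bool) → count p ≡ cnt p
count≡cnt p = sum-allFin (ind ∘ p)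

sumFin-if : ∀ {n} (p : Fin n → Bool) (a b : ℕ) →
  sumFin (λ i → if p i then a else b) ≡ a * cnt p + b * cnt (not ∘ p)
sumFin-if {zero} p a b = sym (cong₂ _+_ (*-zeroʳ a) (*-zeroʳ b))
sumFin-if {suc n} p a b with p zero | sumFin-if (p ∘ suc) a b
... | true | ih = begin
    a + sumFin (λ i → if p (suc i) then a else b)   ≡⟨ cong (a +_) ih ⟩
    a + (a * x + b * y)                              ≡⟨ sym (+-assoc a _ _) ⟩
    a + a * x + b * y                                ≡⟨ cong (_+ b * y) (sym (*-suc a x)) ⟩
    a * suc x + b * y                                ∎
  where
  open ≡-Reasoning
  x = cnt (p ∘ suc)
  y = cnt (not ∘ p ∘ suc)
... | false | ih = begin
    b + sumFin (λ i → if p (suc i) then a else b)   ≡⟨ cong (b +_) ih ⟩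
    b + (a * x + b * y)                              ≡⟨ x+[y+z]≡y+[x+z] b (a * x) (b * y) ⟩
    a * x + (b + b * y)                              ≡⟨ cong (a * x +_) (sym (*-suc b y)) ⟩
    a * x + b * suc y                                ∎
  where
  open ≡-Reasoning
  x = cnt (p ∘ suc)
  y = cnt (not ∘ p ∘ suc)
  x+[y+z]≡y+[x+z] : ∀ u v w → u + (v + w) ≡ v + (u + w)
  x+[y+z]≡y+[x+z] u v w = trans (sym (+-assoc u v w)) (trans (cong (_+ w) (+-comm u v)) (+-assoc v u w))

cnt-compl : ∀ {n} (p : Fin n → Bool) → cnt p + cnt (not ∘ p) ≡ n
cnt-compl {zero} p = refl
cnt-compl {suc n} p with p zero | cnt-compl (p ∘ suc)
... | true | ih = cong suc ih
... | false | ih = trans (+-suc (cnt (p ∘ suc)) _) (cong suc ih)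

_⊆_ : ∀ {n} → (Fin n → Bool) → (Fin n → Bool) → Set
p ⊆ q = ∀ i → p i ≡ true → q i ≡ true

ind-mono : ∀ {b c} → (b ≡ true → c ≡ true) → ind b ≤ ind c
ind-mono {false} b⇒c = z≤n
ind-mono {true} b⇒c rewrite b⇒c refl = ≤-refl

ind-injective : ∀ {b c} → ind b ≡ ind c → b ≡ c
ind-injective {false} {false} _ = refl
ind-injective {true} {true} _ = refl

cnt-mono : ∀ {n} {p q : Fin n → Bool} → p ⊆ q → cnt p ≤ cnt q
cnt-mono p⊆q = sumFin-mono (λ i → ind-mono (p⊆q i))

cnt-mono-< : ∀ {n} {p q : Fin n → Bool} → p ⊆ q →
  (a : Fin n) → q a ≡ true → p a ≡ false → cnt p < cnt q
cnt-mono-< {p = p} {q} p⊆q a qa pa = sumFin-mono-< (λ i → ind-mono (p⊆q i)) a ind-pa<ind-qa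
  where
  ind-pa<ind-qa : ind (p a) < ind (q a)
  ind-pa<ind-qa rewrite qa | pa = s≤s z≤n

cnt-tight : ∀ {n} {p q : Fin n → Bool} → p ⊆ q → cnt p ≡ cnt q → q ⊆ p
cnt-tight p⊆q cnts≡ i qi =
  trans (ind-injective (sumFin-tight (λ j → ind-mono (p⊆q j)) cnts≡ i)) qi

_∖_ : ∀ {n} → (Fin n → Bool) → Fin n → (Fin n → Bool)
(p ∖ a) x = p x ∧ not ⌊ x ≟ᶠ a ⌋

∖-removes : ∀ {n} (p : Fin n → Bool) a → (p ∖ a) a ≡ false
∖-removes p a with a ≟ᶠ a
... | yes _ = ∧-zeroʳ (p a)
... | no a≢a = ⊥-elim (a≢a refl)

∖-keeps : ∀ {n} {p : Fin n → Bool} {a b} → p b ≡ true → b ≢ a → (p ∖ a) b ≡ true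
∖-keeps {p = p} {a} {b} pb b≢a with b ≟ᶠ a
... | yes b≡a = ⊥-elim (b≢a b≡a)
... | no _ = trans (∧-identityʳ (p b)) pb

cnt-∖ : ∀ {n} {p : Fin n → Bool} {a} → p a ≡ true → cnt (p ∖ a) < cnt p
cnt-∖ {p = p} {a} pa = cnt-mono-< (λ x px∧ → ∧-left (p x) px∧) a pa (∖-removes p a)
  where
  ∧-left : ∀ b {c} → b ∧ c ≡ true → b ≡ true
  ∧-left true _ = refl

three≤cnt : ∀ {n} {p : Fin n → Bool} {a b c} →
  p a ≡ true → p b ≡ true → p c ≡ true → a ≢ b → a ≢ c → b ≢ c → 3 ≤ cnt p
three≤cnt {p = p} {a} {b} {c} pa pb pc a≢b a≢c b≢c =
  ≤-trans (s≤s (s≤s (≤-trans (s≤s z≤n) (cnt-∖ {p = (p ∖ a) ∖ b} qc))))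
          (≤-trans (s≤s (cnt-∖ {p = p ∖ a} p∖a-b)) (cnt-∖ {p = p} pa))
  where
  p∖a-b : (p ∖ a) b ≡ true
  p∖a-b = ∖-keeps {p = p} pb (a≢b ∘ sym)
  qc : ((p ∖ a) ∖ b) c ≡ true
  qc = ∖-keeps {p = p ∖ a} (∖-keeps {p = p} pc (a≢c ∘ sym)) (b≢c ∘ sym)

argmax : ∀ {n} (f : Fin (suc n) → ℕ) → Σ (Fin (suc n)) λ v → ∀ u → f u ≤ f v
argmax {zero} f = zero , λ { zero → ≤-refl }
argmax {suc n} f with argmax (f ∘ suc)
... | w , f≤fw with f zero ≤? f (suc w)
... | yes f0≤fw = suc w , λ { zero → f0≤fw ; (suc u) → f≤fw u }
... | no f0≰fw = zero , λ { zero → ≤-refl ; (suc u) → ≤-trans (f≤fw u) (<⇒≤ (≰⇒> f0≰fw)) }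

C-step : ∀ k d → d C k ≤ suc d C k
C-step zero d = ≤-refl
C-step (suc k) d = subst (d C suc k ≤_) (nCk+nC[k+1]≡[n+1]C[k+1] d k) (m≤n+m _ _)

C-mono : ∀ k {d D} → d ≤ D → d C k ≤ D C k
C-mono k {d} d≤D = go (≤⇒≤′ d≤D)
  where
  go : ∀ {D} → d ≤′ D → d C k ≤ D C k
  go ≤′-refl = ≤-refl
  go (≤′-step {D} d≤′D) = ≤-trans (go d≤′D) (C-step k D)

-- C(d,k) > 0 for k ≤ d; this is what makes the Pascal step strict.
C-pos : ∀ {k d} → k ≤ d → 0 < d C k
C-pos {zero} _ = s≤s z≤n
C-pos {suc k} {suc d} (s≤s k≤d) =
  subst (0 <_) (nCk+nC[k+1]≡[n+1]C[k+1] d k) (≤-trans (C-pos k≤d) (m≤m+n _ _))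

C-mono-< : ∀ k {d D} → d < D → suc k ≤ D → d C suc k < D C suc k
C-mono-< k {d} {suc D} (s≤s d≤D) (s≤s k≤D) =
  ≤-<-trans (C-mono (suc k) d≤D)
    (subst (D C suc k <_) (nCk+nC[k+1]≡[n+1]C[k+1] D k) (+-monoˡ-< (D C suc k) (C-pos k≤D)))

C-tight : ∀ k {d D} → d ≤ D → suc k ≤ D → d C suc k ≡ D C suc k → d ≡ D
C-tight k d≤D k<D Cs≡ with m≤n⇒m<n∨m≡n d≤D
... | inj₂ d≡D = d≡D
... | inj₁ d<D = ⊥-elim (<⇒≢ (C-mono-< k d<D k<D) Cs≡)

xor-comm : ∀ a b → (a xor b) ≡ (b xor a)
xor-comm true true = refl
xor-comm true false = refl
xor-comm false true = refl
xor-comm false false = refl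

xor-self : ∀ a → (a xor a) ≡ false
xor-self true = refl
xor-self false = refl

completeBipartite : ∀ {n} → (Fin n → Bool) → Graph n
completeBipartite s = record
  { adj = λ i j → s i xor s j
  ; sym = λ i j → xor-comm (s i) (s j)
  ; irrefl = λ i → xor-self (s i)
  }

completeBipartite-triangleFree : ∀ {n} (s : Fin n → Bool) → TriangleFree (completeBipartite s)
completeBipartite-triangleFree s i j l with s i | s j | s l
... | true | true | _ = λ ()
... | false | false | _ = λ ()
... | true | false | true = λ _ _ → refl
... | true | false | false = λ { _ () }
... | false | true | true = λ { _ () }
... | false | true | false = λ _ _ → refl

eφ-sumFin : ∀ {n} k (G : Graph n) → eφ k G ≡ sumFin (λ i → cnt (adj G i) C k)
eφ-sumFin k G = trans (sum-allFin (λ i → degree G i C k))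
                      (sumFin-cong (λ i → cong (_C k) (count≡cnt (adj G i))))

completeBipartite-degree : ∀ {n} (s : Fin n → Bool) i →
  cnt (adj (completeBipartite s) i) ≡ (if s i then cnt (not ∘ s) else cnt s)
completeBipartite-degree s i with s i
... | true = sumFin-cong (λ j → ind-true-xor (s j))
  where
  ind-true-xor : ∀ b → ind (true xor b) ≡ ind (not b)
  ind-true-xor true = refl
  ind-true-xor false = refl
... | false = refl

eφ-completeBipartite : ∀ {n} k (s : Fin n → Bool) →
  eφ k (completeBipartite s) ≡ eφK k (cnt s) (cnt (not ∘ s))
eφ-completeBipartite k s = begin
    eφ k (completeBipartite s)
      ≡⟨ eφ-sumFin k (completeBipartite s) ⟩
    sumFin (λ i → cnt (adj (completeBipartite s) i) C k)
      ≡⟨ sumFin-cong (λ i → trans (cong (_C k) (completeBipartite-degree s i)) (if-float (_C k) (s i))) ⟩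
    sumFin (λ i → if s i then cnt (not ∘ s) C k else cnt s C k)
      ≡⟨ sumFin-if s _ _ ⟩
    eφK k (cnt s) (cnt (not ∘ s)) ∎
  where open ≡-Reasoning

firstVertices : (n y : ℕ) → Fin n → Bool
firstVertices (suc n) zero i = false
firstVertices (suc n) (suc y) zero = true
firstVertices (suc n) (suc y) (suc i) = firstVertices n y i

cnt-firstVertices : ∀ n y → y ≤ n → cnt (firstVertices n y) ≡ y
cnt-firstVertices zero zero _ = refl
cnt-firstVertices (suc n) zero _ = trans (sumFin-const n 0) (*-zeroʳ n)
cnt-firstVertices (suc n) (suc y) (s≤s y≤n) = cong suc (cnt-firstVertices n y y≤n)

completeBipartite-realises : ∀ k {n} y c → y + c ≡ n →
  Σ (Fin n → Bool) λ s → eφ k (completeBipartite s) ≡ eφK k y c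
completeBipartite-realises k {n} y c y+c≡n =
  s , trans (eφ-completeBipartite k s) (cong₂ (eφK k) #s≡y #¬s≡c)
  where
  s = firstVertices n y
  #s≡y : cnt s ≡ y
  #s≡y = cnt-firstVertices n y (subst (y ≤_) y+c≡n (m≤m+n y c))
  #¬s≡c : cnt (not ∘ s) ≡ c
  #¬s≡c = +-cancelˡ-≡ y _ _ (trans (cong (_+ cnt (not ∘ s)) (sym #s≡y)) (trans (cnt-compl s) (sym y+c≡n)))

bool-clash : ∀ {b} → b ≡ true → b ≡ false → ⊥
bool-clash refl ()

module Extremal {n : ℕ} (G : Graph (suc n)) (triangleFree : TriangleFree G)
  (extremal : ∀ (H : Graph (suc n)) → TriangleFree H → eφ 3 H ≤ eφ 3 G) (3≤n : 3 ≤ n) where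

  adj-sym : ∀ i j → adj G i j ≡ adj G j i
  adj-sym = Graph.sym G

  deg : Fin (suc n) → ℕ
  deg u = cnt (adj G u)

  v : Fin (suc n)
  v = proj₁ (argmax deg)

  N : Fin (suc n) → Bool
  N = adj G v

  Δ m : ℕ
  Δ = cnt N
  m = cnt (not ∘ N)

  deg≤Δ : ∀ u → deg u ≤ Δ
  deg≤Δ = proj₂ (argmax deg)

  Δ+m≡n : Δ + m ≡ suc n
  Δ+m≡n = cnt-compl N

  -- No triangle through v: the neighbourhood of a neighbour of v avoids N.
  nbr-of-nbr : ∀ {u} w → N u ≡ true → adj G u w ≡ true → N w ≡ false
  nbr-of-nbr {u} w Nu uw = trans (adj-sym v w) (triangleFree v u w Nu uw)

  nbr-deg≤m : ∀ {u} → N u ≡ true → deg u ≤ m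
  nbr-deg≤m Nu = cnt-mono (λ w uw → cong not (nbr-of-nbr w Nu uw))

  bound : Fin (suc n) → ℕ
  bound u = if N u then m C 3 else Δ C 3

  deg-bound : ∀ u → deg u C 3 ≤ bound u
  deg-bound u with N u in Nu
  ... | true = C-mono 3 (nbr-deg≤m Nu)
  ... | false = C-mono 3 (deg≤Δ u)

  sum-bound : sumFin bound ≡ eφK 3 Δ m
  sum-bound = sumFin-if N _ _

  eφ-upper : eφ 3 G ≤ eφK 3 Δ m
  eφ-upper = begin
    eφ 3 G                          ≡⟨ eφ-sumFin 3 G ⟩
    sumFin (λ u → deg u C 3)        ≤⟨ sumFin-mono deg-bound ⟩
    sumFin bound                    ≡⟨ sum-bound ⟩
    eφK 3 Δ m                       ∎
    where open ≤-Reasoning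

  eφK≤eφ : ∀ y c → y + c ≡ suc n → eφK 3 y c ≤ eφ 3 G
  eφK≤eφ y c y+c≡n with completeBipartite-realises 3 y c y+c≡n
  ... | s , eφ≡ = subst (_≤ eφ 3 G) eφ≡ (extremal (completeBipartite s) (completeBipartite-triangleFree s))

  eφK-maximal : ∀ y c → y + c ≡ suc n → eφK 3 y c ≤ eφK 3 Δ m
  eφK-maximal y c y+c≡n = ≤-trans (eφK≤eφ y c y+c≡n) eφ-upper

  -- Equality e_φ(G) = e_φ(K_{Δ,m}) forces every degree bound to be attained.
  deg-tight : ∀ u → deg u C 3 ≡ bound u
  deg-tight = sumFin-tight deg-bound (begin
    sumFin (λ u → deg u C 3)   ≡⟨ sym (eφ-sumFin 3 G) ⟩
    eφ 3 G                     ≡⟨ ≤-antisym eφ-upper (eφK≤eφ Δ m Δ+m≡n) ⟩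
    eφK 3 Δ m                  ≡⟨ sym sum-bound ⟩
    sumFin bound               ∎)
    where open ≡-Reasoning

  -- The star K_{1,n} gives e_φ(G) ≥ C(n,3) ≥ 1, while Δ ≤ 2 would give e_φ(G) = 0.
  3≤Δ : 3 ≤ Δ
  3≤Δ with 3 ≤? Δ
  ... | yes 3≤Δ = 3≤Δ
  ... | no 3≰Δ = ⊥-elim (<⇒≱ (≤-trans 1≤eφ eφ≤max) (≤-reflexive max≡0))
    where
    1≤eφ : 1 ≤ eφ 3 G
    1≤eφ = ≤-trans (C-mono 3 3≤n)
             (≤-trans (≤-reflexive (sym (*-identityʳ (n C 3)))) (≤-trans (m≤m+n _ _) (eφK≤eφ 1 n refl)))
    eφ≤max : eφ 3 G ≤ sumFin {suc n} (λ _ → Δ C 3)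
    eφ≤max = subst (_≤ sumFin {suc n} (λ _ → Δ C 3)) (sym (eφ-sumFin 3 G)) (sumFin-mono (λ u → C-mono 3 (deg≤Δ u)))
    max≡0 : sumFin {suc n} (λ _ → Δ C 3) ≡ 0
    max≡0 = trans (sumFin-const (suc n) _) (trans (cong (suc n *_) (k>n⇒nCk≡0 (≰⇒> 3≰Δ))) (*-zeroʳ (suc n)))

  out-deg : ∀ {j} → N j ≡ false → deg j ≡ Δ
  out-deg {j} Nj = C-tight 2 (deg≤Δ j) 3≤Δ (trans (deg-tight j) (cong (if_then m C 3 else Δ C 3) Nj))

  -- If m ≥ 3, neighbours of v have degree m, hence see every non-neighbour.
  in-sees-out : 3 ≤ m → ∀ {i j} → N i ≡ true → N j ≡ false → adj G i j ≡ true
  in-sees-out 3≤m {i} {j} Ni Nj =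
    cnt-tight (λ w iw → cong not (nbr-of-nbr w Ni iw)) deg≡m j (cong not Nj)
    where
    deg≡m : deg i ≡ m
    deg≡m = C-tight 2 (nbr-deg≤m Ni) 3≤m (trans (deg-tight i) (cong (if_then m C 3 else Δ C 3) Ni))

  -- An edge ij between non-neighbours makes v, i, j three distinct non-neighbours.
  out-edge⇒3≤m : ∀ {i j} → N i ≡ false → N j ≡ false → adj G i j ≡ true → 3 ≤ m
  out-edge⇒3≤m {i} {j} Ni Nj ij =
    three≤cnt {p = not ∘ N} (cong not (Graph.irrefl G v)) (cong not Ni) (cong not Nj) v≢i v≢j i≢j
    where
    v≢i : v ≢ i
    v≢i refl = bool-clash ij Nj
    v≢j : v ≢ j
    v≢j refl = bool-clash (trans (adj-sym v i) ij) Ni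
    i≢j : i ≢ j
    i≢j refl = bool-clash ij (Graph.irrefl G i)

  -- Non-neighbours of v are pairwise non-adjacent: such an edge gives m ≥ 3, so
  -- N lies in the neighbourhood of i, and degree Δ makes them equal.
  out-out : ∀ {i j} → N i ≡ false → N j ≡ false → adj G i j ≡ false
  out-out {i} {j} Ni Nj with adj G i j in ij
  ... | false = refl
  ... | true = ⊥-elim (bool-clash (cnt-tight N⊆Ni (sym (out-deg Ni)) j ij) Nj)
    where
    N⊆Ni : N ⊆ adj G i
    N⊆Ni w Nw = trans (adj-sym i w) (in-sees-out (out-edge⇒3≤m Ni Nj ij) Nw Ni)

  -- A non-neighbour j of v has neighbourhood inside N and of size Δ, hence equal to N.
  in-out : ∀ {i j} → N i ≡ true → N j ≡ false → adj G i j ≡ true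
  in-out {i} {j} Ni Nj = trans (adj-sym i j) (cnt-tight Nj⊆N (out-deg Nj) i Ni)
    where
    Nj⊆N : adj G j ⊆ N
    Nj⊆N w jw with N w in Nw
    ... | true = refl
    ... | false = ⊥-elim (bool-clash jw (out-out Nj Nw))

  in-in : ∀ {i j} → N i ≡ true → N j ≡ true → adj G i j ≡ false
  in-in {i} {j} Ni Nj with adj G i j in ij
  ... | false = refl
  ... | true = ⊥-elim (bool-clash Nj (nbr-of-nbr j Ni ij))

  adj≡xor : ∀ i j → adj G i j ≡ (N i xor N j)
  adj≡xor i j with N i in Ni | N j in Nj
  ... | true | true = in-in Ni Nj
  ... | true | false = in-out Ni Nj
  ... | false | true = trans (adj-sym i j) (in-out Nj Ni)
  ... | false | false = out-out Ni Nj

  inGstar : InGstar G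
  inGstar = Δ , closest (suc n) Δ m Δ+m≡n eφK-maximal , N , count≡cnt N , adj≡xor

theorem4 : (n : ℕ) → 6 ≤ n → (G : Graph n) → IsExtremal 3 G → InGstar G
theorem4 (suc n) 6≤n G (triangleFree , extremal) =
  Extremal.inGstar G triangleFree extremal (≤-pred (≤-trans (s≤s (s≤s (s≤s (s≤s z≤n)))) 6≤n))
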